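{- Let $\Gamma=([n],E)$ be a simple graph and $m\in\mathbb{N}$, and let $Q_{\Gamma,m}=\sum_{S\subseteq[n],\,|S|\le m+1,\,\Gamma|_S\text{ connected}}\Delta_S$ be its $m$-graph polytope. Then $F_q(Q_{\Gamma,m})=\Psi^m_q(\Gamma^{\mathbf 1})$.
   Context: $\Delta_S=\mathrm{conv}\{e_s:s\in S\}\subset\mathbb{R}^n$ for standard basis vectors $e_s$, and sums are Minkowski sums. Let $\mathsf{H}_m(\Gamma)=\{S\subseteq[n]:|S|\le m+1,\ \Gamma|_S\text{ connected}\}$, a hypergraph on $[n]$. A flag is a chain $\mathcal{F}:\emptyset=F_0\subset F_1\subset\cdots\subset F_k=[n]$ ($k\ge1$, strict inclusions); its type is the composition $(|F_1|-|F_0|,\ldots,|F_k|-|F_{k-1}|)$ of $n$, and $M_{\mathcal F}$ denotes the monomial quasisymmetric function $M_{\mathsf{type}(\mathcal F)}$. For a hypergraph $\mathsf{H}$ on $[n]$: $\mathsf{H}|_F=\{H\in\mathsf{H}:H\subseteq F\}$, $\mathsf{H}/F=\{H\setminus F:H\in\mathsf{H}\}$, $\mathsf{H}/\mathcal{F}=\bigsqcup_{i=1}^k(\mathsf{H}|_{F_i})/F_{i-1}$ (a hypergraph on the vertex set $\bigsqcup_i (F_i\setminus F_{i-1})=[n]$), $c(\mathsf H/\mathcal F)$ its number of connected components, $\mathsf{rk}(\mathsf{H}/\mathcal{F})=n-c(\mathsf{H}/\mathcal{F})$, and the weighted integer points enumerator of $Q_{\mathsf H}=\sum_{H\in\mathsf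 H}\Delta_H$ is $F_q(Q_{\mathsf H})=\sum_{\mathcal F}q^{\mathsf{rk}(\mathsf H/\mathcal F)}M_{\mathcal F}$, the sum over all flags; here $F_q(Q_{\Gamma,m})$ means $F_q(Q_{\mathsf H_m(\Gamma)})$. Decorated graphs: a simple graph with a map $w:E\to\mathbb{N}$; $\Gamma^{\mathbf 1}$ is $\Gamma$ with all decorations $1$. For $S\subseteq V$, $\Gamma^w|_S$ is the induced decorated subgraph; $\Gamma^w/S$ is the decorated graph on $V\setminus S$ with the induced edges plus an edge $uv$ for each pair $u,v\notin S$ joined by a path whose interior vertices lie in $S$, decorated by the minimum sum of decorations along such paths. $\mathrm{pr}_m$ deletes all edges of decoration $>m$. For a flag $\mathcal F$, $\mathsf{rk}_m(\Gamma^w/\mathcal F)=n-\sum_{i=1}^k c(\mathrm{pr}_m(\Gamma^w|_{F_i}/F_{i-1}))$, with $c$ the number of connected components. Then $\Psi^m_q(\Gamma^w)=\sum_{\mathcal F}q^{\mathsf{rk}_m(\Gamma^w/\mathcal F)}M_{\mathcal F}$ (sum over all flags of $[n]$); equivalently $\Psi^m_q$ is the unique morphism of combinatorial Hopf algebras from the Hopf algebra of decorated graphs with coproduct $\Delta_m(\Gamma^w)=\sum_{S}\mathrm{pr}_m(\Gamma^w|_S)\otimes\mathrm{pr}_m(\Gamma^w/S)$, disjoint-union product, and character $\zeta_q(\Gamma^w)=q^{n-c(\Gamma^w)}$, to quasisymmetric functions with their canonical character. -}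

module Defs where

open import Data.Bool using (Bool; true; false; _∧_; _∨_; not; if_then_else_)
open import Data.Nat using (ℕ; zero; suc; _+_; _∸_; _≡ᵇ_; _<ᵇ_; _≤ᵇ_)
open import Data.Fin using (Fin; toℕ)
open import Data.Vec using (Vec; []; _∷_; lookup; zipWith; replicate)
open import Data.List using (List; []; _∷_; [_]; map; concatMap; filterᵇ; length; foldr; null; concat)
open import Data.Bool.ListAction using (all; any)
open import Data.Maybe using (Maybe; just; nothing; is-just)
open import Data.Product using (_×_; _,_)
open import Data.Fin.Subset using (Subset; ∣_∣)
open import Relation.Binary.PropositionalEquality using (_≡_)
open import Data.List.Relation.Binary.Permutation.Propositional using (_↭_)

-- Finite sets: vertex set [n] is Fin n, subsets are Data.Fin.Subset n
-- (Vec Bool n, true = inside).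

vertices : ∀ n → List (Fin n)
vertices n = Data.List.allFin n

mem : ∀ {n} → Subset n → Fin n → Bool
mem S i = lookup S i

emptySet : ∀ {n} → Subset n
emptySet = replicate _ false

fullSet : ∀ {n} → Subset n
fullSet = replicate _ true

_∩ᵇ_ : ∀ {n} → Subset n → Subset n → Subset n
S ∩ᵇ T = zipWith _∧_ S T

_∖ᵇ_ : ∀ {n} → Subset n → Subset n → Subset n
S ∖ᵇ T = zipWith (λ a b → a ∧ not b) S T

subsets : ∀ n → List (Subset n)
subsets zero = [ [] ]
subsets (suc n) = concatMap (λ s → (false ∷ s) ∷ (true ∷ s) ∷ []) (subsets n)

_⊆ᵇ_ : ∀ {n} → Subset n → Subset n → Bool
_⊆ᵇ_ {n} S T = all (λ i → not (mem S i) ∨ mem T i) (vertices n)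

_⊂ᵇ_ : ∀ {n} → Subset n → Subset n → Bool
S ⊂ᵇ T = (S ⊆ᵇ T) ∧ (∣ S ∣ <ᵇ ∣ T ∣)

_≡ᶠ_ : ∀ {n} → Fin n → Fin n → Bool
u ≡ᶠ v = toℕ u ≡ᵇ toℕ v

-- Flags.  A flag ∅ = F₀ ⊂ F₁ ⊂ ⋯ ⊂ F_k = [n] (k ≥ 1) is represented by
-- the list F₁ ∷ ⋯ ∷ F_k ∷ [] (F₀ = ∅ implicit).

Flag : ℕ → Set
Flag n = List (Subset n)

-- all strict chains S ⊂ T₁ ⊂ ⋯ ⊂ T_j = [n] starting above S (fuel bounds
-- the length; each step increases the size, so fuel n suffices)
chainsFrom : ∀ {n} → ℕ → Subset n → List (Flag n)
chainsFrom {n} fuel S with ∣ S ∣ ≡ᵇ n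
... | true = [ [] ]
chainsFrom {n} zero S | false = []
chainsFrom {n} (suc f) S | false =
  concatMap (λ T → map (T ∷_) (chainsFrom f T)) (filterᵇ (λ T → S ⊂ᵇ T) (subsets n))

allFlags : ∀ n → List (Flag n)
allFlags n = filterᵇ (λ F → not (null F)) (chainsFrom n emptySet)

typeFrom : ∀ {n} → Subset n → Flag n → List ℕ
typeFrom P [] = []
typeFrom P (F ∷ Fs) = (∣ F ∣ ∸ ∣ P ∣) ∷ typeFrom F Fs

flagType : ∀ {n} → Flag n → List ℕ
flagType F = typeFrom emptySet F

reach : ∀ {n} → Subset n → (Fin n → Fin n → Bool) → ℕ → Fin n → Fin n → Bool
reach V E zero u v = u ≡ᶠ v
reach {n} V E (suc k) u v =
  reach V E k u v ∨ any (λ x → mem V x ∧ reach V E k u x ∧ E x v) (vertices n)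

-- number of connected components of the graph (V, E): count the vertices
-- of V that are the smallest vertex of their component
components : ∀ {n} → Subset n → (Fin n → Fin n → Bool) → ℕ
components {n} V E = length (filterᵇ isLeader (vertices n))
  where
  isLeader : Fin n → Bool
  isLeader v = mem V v ∧ not (any (λ u → mem V u ∧ (toℕ u <ᵇ toℕ v) ∧ reach V E n u v) (vertices n))

Hypergraph : ℕ → Set
Hypergraph n = List (Subset n)

restrictH : ∀ {n} → Hypergraph n → Subset n → Hypergraph n
restrictH H F = filterᵇ (λ h → h ⊆ᵇ F) H

contractH : ∀ {n} → Hypergraph n → Subset n → Hypergraph n
contractH H F = map (λ h → h ∖ᵇ F) H

-- H / 𝓕 = ⊔ᵢ (H|_{Fᵢ}) / F_{i-1}
quotFrom : ∀ {n} → Hypergraph n → Subset n → Flag n → Hypergraph n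
quotFrom H P [] = []
quotFrom H P (F ∷ Fs) = contractH (restrictH H F) P Data.List.++ quotFrom H F Fs

quotFlag : ∀ {n} → Hypergraph n → Flag n → Hypergraph n
quotFlag H F = quotFrom H emptySet F

componentsH : ∀ {n} → Hypergraph n → ℕ
componentsH H = components fullSet (λ u v → any (λ h → mem h u ∧ mem h v) H)

rkH : ∀ {n} → Hypergraph n → ℕ
rkH {n} H = n ∸ componentsH H

-- Quasisymmetric functions with coefficients in ℕ[q], in the monomial
-- basis: a formal sum of terms q^r M_α, stored as a list of (r , α).
-- Since {q^r M_α} is a basis, two such elements are equal iff the
-- multisets of terms agree, i.e. the lists are permutations of each other.

QTerm : Set
QTerm = ℕ × List ℕ

QSymq : Set
QSymq = List QTerm

_≈Q_ : QSymq → QSymq → Set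
f ≈Q g = f ↭ g

Fq : ∀ {n} → Hypergraph n → QSymq
Fq {n} H = map (λ F → (rkH (quotFlag H F) , flagType F)) (allFlags n)

record SimpleGraph (n : ℕ) : Set where
  field
    adj        : Fin n → Fin n → Bool
    adj-sym    : ∀ u v → adj u v ≡ adj v u
    adj-irrefl : ∀ u → adj u u ≡ false
open SimpleGraph public

connectedOn : ∀ {n} → SimpleGraph n → Subset n → Bool
connectedOn Γ S = components S (adj Γ) ≡ᵇ 1

Hm : ∀ {n} → ℕ → SimpleGraph n → Hypergraph n
Hm {n} m Γ = filterᵇ (λ S → (∣ S ∣ ≤ᵇ suc m) ∧ connectedOn Γ S) (subsets n)

FqGraph : ∀ {n} → SimpleGraph n → ℕ → QSymq
FqGraph Γ m = Fq (Hm m Γ)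

-- Decorated graphs: a vertex set V ⊆ [n] and a decoration
-- dec u v = just w (edge uv of decoration w) or nothing (no edge).

record DGraph (n : ℕ) : Set where
  field
    verts : Subset n
    dec   : Fin n → Fin n → Maybe ℕ
open DGraph public

Γ¹ : ∀ {n} → SimpleGraph n → DGraph n
Γ¹ Γ = record { verts = fullSet
              ; dec = λ u v → if adj Γ u v then just 1 else nothing }

minM : Maybe ℕ → Maybe ℕ → Maybe ℕ
minM nothing b = b
minM (just a) nothing = just a
minM (just a) (just b) = just (Data.Nat._⊓_ a b)

addM : Maybe ℕ → Maybe ℕ → Maybe ℕ
addM (just a) (just b) = just (a + b)
addM _ _ = nothing

restrictD : ∀ {n} → DGraph n → Subset n → DGraph n
restrictD G S = record
  { verts = verts G ∩ᵇ S
  ; dec = λ u v → if mem (verts G ∩ᵇ S) u ∧ mem (verts G ∩ᵇ S) v then dec G u v else nothing }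

-- minimal total decoration of a path u → v with ≤ k+1 edges whose
-- interior vertices lie in I (I ⊆ vertices)
pathMin : ∀ {n} → DGraph n → Subset n → ℕ → Fin n → Fin n → Maybe ℕ
pathMin G I zero u v = dec G u v
pathMin {n} G I (suc k) u v =
  minM (pathMin G I k u v)
       (foldr minM nothing
         (map (λ x → if mem I x then addM (pathMin G I k u x) (dec G x v) else nothing)
              (vertices n)))

-- Paths with at most n+1 edges suffice (simple paths), hence pathMin … n.
contractD : ∀ {n} → DGraph n → Subset n → DGraph n
contractD {n} G S = record
  { verts = verts G ∖ᵇ S
  ; dec = λ u v → if mem (verts G ∖ᵇ S) u ∧ mem (verts G ∖ᵇ S) v ∧ not (u ≡ᶠ v)
                  then pathMin G (verts G ∩ᵇ S) n u v else nothing }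

prD : ∀ {n} → ℕ → DGraph n → DGraph n
prD m G = record
  { verts = verts G
  ; dec = λ u v → keep (dec G u v) }
  where
  keep : Maybe ℕ → Maybe ℕ
  keep nothing = nothing
  keep (just w) = if w ≤ᵇ m then just w else nothing

componentsD : ∀ {n} → DGraph n → ℕ
componentsD G = components (verts G) (λ u v → is-just (dec G u v))

compSumFrom : ∀ {n} → ℕ → DGraph n → Subset n → Flag n → ℕ
compSumFrom m G P [] = 0
compSumFrom m G P (F ∷ Fs) =
  componentsD (prD m (contractD (restrictD G F) P)) + compSumFrom m G F Fs

rkm : ∀ {n} → ℕ → DGraph n → Flag n → ℕ
rkm {n} m G F = n ∸ compSumFrom m G emptySet F

Ψ : ∀ {n} → ℕ → DGraph n → QSymq
Ψ {n} m G = map (λ F → (rkm m G F , flagType F)) (allFlags n)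

{-# OPTIONS --safe #-}
module Submission where

-- Both sides list one term per flag 𝓕 with the same monomial M_𝓕, so it suffices to show
-- c(H_m(Γ)/𝓕) = Σᵢ c(pr_m(Γ|Fᵢ / Fᵢ₋₁)).  Both counts are counts of component leaders (least
-- vertices of components), and every vertex lies in exactly one block Fᵢ ∖ Fᵢ₋₁; so it suffices
-- that, inside a block, the hypergraph H/𝓕 and the graph pr_m(Γ|Fᵢ / Fᵢ₋₁) have the same
-- connectivity.  An edge uv of the latter is a walk of length ≤ m in Γ|Fᵢ with interior in Fᵢ₋₁;
-- its vertex set is connected of size ≤ m + 1, i.e. a hyperedge of H_m(Γ) inside Fᵢ containing
-- u and v.  Conversely, a hyperedge S ⊆ Fᵢ is connected with |S| ≤ m + 1; a simple path in Γ|S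
-- between two vertices outside Fᵢ₋₁ splits at its vertices outside Fᵢ₋₁ into pieces of length
-- ≤ m with interior in Fᵢ₋₁, which are edges of pr_m(Γ|Fᵢ / Fᵢ₋₁).

open import Defs
open import Data.Bool using (Bool; true; false; _∧_; _∨_; not; if_then_else_; T?)
open import Data.Bool.Properties using (∨-zeroʳ; not-injective; T-≡)
open import Function.Base using (_∘′_)
open import Function.Bundles using (Equivalence)
open import Data.Bool.ListAction using (any; all)
open import Data.Nat using (ℕ; zero; suc; _+_; _∸_; _≤_; _<_; z≤n; s≤s; _≡ᵇ_; _<ᵇ_; _≤ᵇ_)
open import Data.Nat.Properties
  using (≤-trans; ≤-refl; ≤-reflexive; ≤-pred; n≤1+n; m≤n⇒m≤1+n; ≤⇒≯; <-cmp; +-comm; +-suc; +-identityʳ;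
         +-monoˡ-≤; m⊓n≤m; m⊓n≤n; ⊓-sel; ≡ᵇ⇒≡; ≡⇒≡ᵇ; <ᵇ⇒<; <⇒<ᵇ; ≤ᵇ⇒≤; ≤⇒≤ᵇ)
open import Data.Nat.Solver using (module +-*-Solver)
open import Data.Fin using (Fin; toℕ; _≟_) renaming (zero to fzero; suc to fsuc)
open import Data.Fin.Properties using (toℕ-injective)
open import Data.Fin.Subset using (Subset; ∣_∣; ⁅_⁆; _∪_)
open import Data.Fin.Subset.Properties using (∣p∣≤n; ∣p∣≡n⇒p≡⊤; ∣⁅x⁆∣≡1; x∈⁅x⁆; x∈⁅y⁆⇒x≡y)
open import Data.Vec using ([]; _∷_)
open import Data.Vec.Properties using (lookup-zipWith; lookup-replicate; []=⇒lookup; lookup⇒[]=)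
open import Data.List using (List; []; _∷_; map; length; filterᵇ; foldr; null; _++_)
open import Data.List.Properties using (map-cong-local)
open import Data.List.Membership.Propositional using (_∈_)
open import Data.List.Membership.Propositional.Properties
  using (∈-allFin; ∈-map⁺; ∈-map⁻; ∈-++⁺ˡ; ∈-++⁺ʳ; ∈-++⁻; ∈-filter⁺; ∈-filter⁻; ∈-concat⁺′; ∈-concat⁻′)
import Data.List.Membership.DecPropositional as DecMembership
open import Data.List.Relation.Unary.Any using (here; there)
open import Data.List.Relation.Unary.All using (All; []; _∷_)
import Data.List.Relation.Unary.All as All
open import Data.List.Relation.Unary.All.Properties.Core using (¬Any⇒All¬)
open import Data.List.Relation.Unary.AllPairs using ([]; _∷_)
open import Data.List.Relation.Unary.Unique.Propositional using (Unique)
open import Data.List.Relation.Unary.Unique.Propositional.Properties using (allFin⁺)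
open import Data.List.Relation.Binary.Permutation.Propositional using (↭-reflexive)
open import Data.Maybe using (Maybe; just; nothing; is-just)
open import Data.Product using (∃; ∃-syntax; _×_; _,_; proj₁; proj₂)
open import Data.Sum using (_⊎_; inj₁; inj₂)
open import Data.Empty using (⊥-elim)
open import Relation.Nullary using (¬_; yes; no)
open import Relation.Binary using (tri<; tri≈; tri>)
open import Relation.Binary.PropositionalEquality

private
  variable
    A : Set
    n : ℕ

true≢false : ¬ true ≡ false
true≢false ()

∧-true⁻ : ∀ {a b} → a ∧ b ≡ true → a ≡ true × b ≡ true
∧-true⁻ {true} {true} _ = refl , refl

∧-leftComm : ∀ a b c → a ∧ (b ∧ c) ≡ b ∧ (a ∧ c)
∧-leftComm true  b     c = refl
∧-leftComm false true  c = refl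
∧-leftComm false false c = refl

∨-true⁻ : ∀ {a b} → a ∨ b ≡ true → a ≡ true ⊎ b ≡ true
∨-true⁻ {true}  _ = inj₁ refl
∨-true⁻ {false} e = inj₂ e

∨-true⁺ˡ : ∀ {a} b → a ≡ true → a ∨ b ≡ true
∨-true⁺ˡ _ refl = refl

∨-true⁺ʳ : ∀ a {b} → b ≡ true → a ∨ b ≡ true
∨-true⁺ʳ a refl = ∨-zeroʳ a

≡-from-true⇔ : ∀ {a b : Bool} → (a ≡ true → b ≡ true) → (b ≡ true → a ≡ true) → a ≡ b
≡-from-true⇔ {true}  {true}  _ _ = refl
≡-from-true⇔ {true}  {false} f _ = sym (f refl)
≡-from-true⇔ {false} {true}  _ g = g refl
≡-from-true⇔ {false} {false} _ _ = refl

≢true⇒≡false : ∀ {b} → ¬ b ≡ true → b ≡ false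
≢true⇒≡false {true}  h = ⊥-elim (h refl)
≢true⇒≡false {false} _ = refl

any-true⁺ : ∀ (f : A → Bool) {x} xs → x ∈ xs → f x ≡ true → any f xs ≡ true
any-true⁺ f (y ∷ ys) (here refl) e = ∨-true⁺ˡ _ e
any-true⁺ f (y ∷ ys) (there i)   e = ∨-true⁺ʳ (f y) (any-true⁺ f ys i e)

any-true⁻ : ∀ (f : A → Bool) xs → any f xs ≡ true → ∃[ x ] x ∈ xs × f x ≡ true
any-true⁻ f (y ∷ ys) e with ∨-true⁻ {f y} e
... | inj₁ fy = y , here refl , fy
... | inj₂ rest with any-true⁻ f ys rest
...   | x , i , fx = x , there i , fx

any-cong : ∀ (f g : A → Bool) xs → (∀ x → f x ≡ g x) → any f xs ≡ any g xs
any-cong f g []       _ = refl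
any-cong f g (x ∷ xs) h = cong₂ _∨_ (h x) (any-cong f g xs h)

all-true⁺ : ∀ (f : A → Bool) xs → (∀ x → x ∈ xs → f x ≡ true) → all f xs ≡ true
all-true⁺ f []       _ = refl
all-true⁺ f (y ∷ ys) h = cong₂ _∧_ (h y (here refl)) (all-true⁺ f ys (λ x i → h x (there i)))

all-true⁻ : ∀ (f : A → Bool) xs → all f xs ≡ true → ∀ x → x ∈ xs → f x ≡ true
all-true⁻ f (y ∷ ys) e x (here refl) = proj₁ (∧-true⁻ e)
all-true⁻ f (y ∷ ys) e x (there i)   = all-true⁻ f ys (proj₂ (∧-true⁻ {f y} e)) x i

∈-filterᵇ⁺ : ∀ (p : A → Bool) {x} xs → x ∈ xs → p x ≡ true → x ∈ filterᵇ p xs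
∈-filterᵇ⁺ p xs i e = ∈-filter⁺ (λ y → T? (p y)) i (Equivalence.from T-≡ e)

∈-filterᵇ⁻ : ∀ (p : A → Bool) {x} xs → x ∈ filterᵇ p xs → x ∈ xs × p x ≡ true
∈-filterᵇ⁻ p xs i with ∈-filter⁻ (λ y → T? (p y)) {xs = xs} i
... | x∈xs , px = x∈xs , Equivalence.to T-≡ px

≡ᶠ⇒≡ : {u v : Fin n} → (u ≡ᶠ v) ≡ true → u ≡ v
≡ᶠ⇒≡ {u = u} {v} e = toℕ-injective (≡ᵇ⇒≡ (toℕ u) (toℕ v) (Equivalence.from T-≡ e))

≡ᶠ-refl : (u : Fin n) → (u ≡ᶠ u) ≡ true
≡ᶠ-refl u = Equivalence.to T-≡ (≡⇒≡ᵇ (toℕ u) (toℕ u) refl)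

≢⇒≡ᶠ-false : {u v : Fin n} → ¬ u ≡ v → (u ≡ᶠ v) ≡ false
≢⇒≡ᶠ-false u≢v = ≢true⇒≡false (λ e → u≢v (≡ᶠ⇒≡ e))

infix 4 _∈ₛ_ _∉ₛ_ _⊆ₛ_

_∈ₛ_ : Fin n → Subset n → Set
i ∈ₛ S = mem S i ≡ true

_∉ₛ_ : Fin n → Subset n → Set
i ∉ₛ S = mem S i ≡ false

_⊆ₛ_ : Subset n → Subset n → Set
S ⊆ₛ T = ∀ i → i ∈ₛ S → i ∈ₛ T

⊆ᵇ⇒⊆ₛ : (S T : Subset n) → (S ⊆ᵇ T) ≡ true → S ⊆ₛ T
⊆ᵇ⇒⊆ₛ {n} S T e i i∈S with all-true⁻ _ (vertices n) e i (∈-allFin i)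
... | r rewrite i∈S = r

⊆ₛ⇒⊆ᵇ : (S T : Subset n) → S ⊆ₛ T → (S ⊆ᵇ T) ≡ true
⊆ₛ⇒⊆ᵇ {n} S T S⊆T = all-true⁺ _ (vertices n) included
  where
  included : ∀ i → i ∈ vertices n → (not (mem S i) ∨ mem T i) ≡ true
  included i _ with mem S i in i∈S
  ... | true  = S⊆T i i∈S
  ... | false = refl

∈ₛ-fullSet : (i : Fin n) → i ∈ₛ fullSet
∈ₛ-fullSet i = lookup-replicate i true

∉ₛ-emptySet : (i : Fin n) → i ∉ₛ emptySet
∉ₛ-emptySet i = lookup-replicate i false

mem-∩ᵇ : (S T : Subset n) (i : Fin n) → mem (S ∩ᵇ T) i ≡ (mem S i ∧ mem T i)
mem-∩ᵇ S T i = lookup-zipWith _∧_ i S T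

mem-∖ᵇ : (S T : Subset n) (i : Fin n) → mem (S ∖ᵇ T) i ≡ (mem S i ∧ not (mem T i))
mem-∖ᵇ S T i = lookup-zipWith (λ a b → a ∧ not b) i S T

mem-∪ : (S T : Subset n) (i : Fin n) → mem (S ∪ T) i ≡ (mem S i ∨ mem T i)
mem-∪ S T i = lookup-zipWith _∨_ i S T

∈ₛ-∖ᵇ⁺ : (S T : Subset n) {i : Fin n} → i ∈ₛ S → i ∉ₛ T → i ∈ₛ S ∖ᵇ T
∈ₛ-∖ᵇ⁺ S T {i} i∈S i∉T rewrite mem-∖ᵇ S T i | i∈S | i∉T = refl

∈ₛ-∖ᵇ⁻ : (S T : Subset n) {i : Fin n} → i ∈ₛ S ∖ᵇ T → i ∈ₛ S × i ∉ₛ T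
∈ₛ-∖ᵇ⁻ S T {i} e rewrite mem-∖ᵇ S T i with mem S i | mem T i | e
... | true | false | _ = refl , refl

∈ₛ-∪⁺ : (S T : Subset n) {i : Fin n} → i ∈ₛ S ⊎ i ∈ₛ T → i ∈ₛ S ∪ T
∈ₛ-∪⁺ S T {i} (inj₁ i∈S) rewrite mem-∪ S T i | i∈S = refl
∈ₛ-∪⁺ S T {i} (inj₂ i∈T) rewrite mem-∪ S T i | i∈T = ∨-zeroʳ (mem S i)

∈ₛ-∪⁻ : (S T : Subset n) {i : Fin n} → i ∈ₛ S ∪ T → i ∈ₛ S ⊎ i ∈ₛ T
∈ₛ-∪⁻ S T {i} e rewrite mem-∪ S T i = ∨-true⁻ e

x∈ₛ⁅x⁆ : (x : Fin n) → x ∈ₛ ⁅ x ⁆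
x∈ₛ⁅x⁆ x = []=⇒lookup (x∈⁅x⁆ x)

x∈ₛ⁅y⁆⇒x≡y : {x : Fin n} (y : Fin n) → x ∈ₛ ⁅ y ⁆ → x ≡ y
x∈ₛ⁅y⁆⇒x≡y {x = x} y e = x∈⁅y⁆⇒x≡y y (lookup⇒[]= x ⁅ y ⁆ e)

∣p∪q∣≤∣p∣+∣q∣ : (p q : Subset n) → ∣ p ∪ q ∣ ≤ ∣ p ∣ + ∣ q ∣
∣p∪q∣≤∣p∣+∣q∣ []          []          = z≤n
∣p∪q∣≤∣p∣+∣q∣ (true ∷ p)  (true ∷ q)  =
  s≤s (≤-trans (∣p∪q∣≤∣p∣+∣q∣ p q) (≤-trans (n≤1+n _) (≤-reflexive (sym (+-suc _ _)))))
∣p∪q∣≤∣p∣+∣q∣ (true ∷ p)  (false ∷ q) = s≤s (∣p∪q∣≤∣p∣+∣q∣ p q)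
∣p∪q∣≤∣p∣+∣q∣ (false ∷ p) (true ∷ q)  = ≤-trans (s≤s (∣p∪q∣≤∣p∣+∣q∣ p q)) (≤-reflexive (sym (+-suc _ _)))
∣p∪q∣≤∣p∣+∣q∣ (false ∷ p) (false ∷ q) = ∣p∪q∣≤∣p∣+∣q∣ p q

∣S∣≡n⇒∈ₛS : (S : Subset n) → ∣ S ∣ ≡ n → ∀ i → i ∈ₛ S
∣S∣≡n⇒∈ₛS S ∣S∣≡n i rewrite ∣p∣≡n⇒p≡⊤ {p = S} ∣S∣≡n = lookup-replicate i true

∈-subsets : (S : Subset n) → S ∈ subsets n
∈-subsets []      = here refl
∈-subsets (b ∷ S) =
  ∈-concat⁺′ (∈-pair b) (∈-map⁺ (λ s → (false ∷ s) ∷ (true ∷ s) ∷ []) (∈-subsets S))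
  where
  ∈-pair : ∀ b → (b ∷ S) ∈ ((false ∷ S) ∷ (true ∷ S) ∷ [])
  ∈-pair false = here refl
  ∈-pair true  = there (here refl)

prefix-length< : ∀ (xs : List A) a rest → suc (length xs) ≤ length (xs ++ a ∷ rest)
prefix-length< []       a rest = s≤s z≤n
prefix-length< (_ ∷ xs) a rest = s≤s (prefix-length< xs a rest)

remove : Subset n → Fin n → Subset n
remove (_ ∷ S) fzero    = false ∷ S
remove (b ∷ S) (fsuc i) = b ∷ remove S i

mem-remove : (S : Subset n) {x w : Fin n} → ¬ x ≡ w → mem (remove S x) w ≡ mem S w
mem-remove (b ∷ S) {fzero}  {fzero}  x≢w = ⊥-elim (x≢w refl)
mem-remove (b ∷ S) {fzero}  {fsuc w} x≢w = refl
mem-remove (b ∷ S) {fsuc x} {fzero}  x≢w = refl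
mem-remove (b ∷ S) {fsuc x} {fsuc w} x≢w = mem-remove S (λ e → x≢w (cong fsuc e))

∣remove∣<∣S∣ : (S : Subset n) {x : Fin n} → x ∈ₛ S → suc ∣ remove S x ∣ ≤ ∣ S ∣
∣remove∣<∣S∣ (true ∷ S)  {fzero}  _ = ≤-refl
∣remove∣<∣S∣ (true ∷ S)  {fsuc x} e = s≤s (∣remove∣<∣S∣ S e)
∣remove∣<∣S∣ (false ∷ S) {fsuc x} e = ∣remove∣<∣S∣ S e

unique-length≤∣S∣ : (S : Subset n) (xs : List (Fin n)) → Unique xs → All (_∈ₛ S) xs → length xs ≤ ∣ S ∣
unique-length≤∣S∣ S []       _             _             = z≤n
unique-length≤∣S∣ S (x ∷ xs) (x∉xs ∷ uniq) (x∈S ∷ xs⊆S) =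
  ≤-trans (s≤s (unique-length≤∣S∣ (remove S x) xs uniq (All.zipWith kept (x∉xs , xs⊆S))))
          (∣remove∣<∣S∣ S x∈S)
  where
  kept : ∀ {w} → ¬ x ≡ w × w ∈ₛ S → w ∈ₛ remove S x
  kept (x≢w , w∈S) = trans (mem-remove S x≢w) w∈S

-- Walks and reachability

-- Path V E u v xs: a walk from u to v along E-edges with vertex list xs, read backwards; every
-- vertex except the endpoint v must lie in V, matching the constraints in reach and pathMin.
data Path (V : Subset n) (E : Fin n → Fin n → Bool) (u : Fin n) : Fin n → List (Fin n) → Set where
  nil  : Path V E u u (u ∷ [])
  snoc : ∀ {x v xs} → Path V E u x xs → x ∈ₛ V → E x v ≡ true → Path V E u v (v ∷ xs)

Reachable : Subset n → (Fin n → Fin n → Bool) → Fin n → Fin n → Set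
Reachable V E u v = ∃ (Path V E u v)

module _ {V : Subset n} {E : Fin n → Fin n → Bool} where

  reachable-refl : ∀ u → Reachable V E u u
  reachable-refl u = _ , nil

  reachable-snoc : ∀ {u x v} → Reachable V E u x → x ∈ₛ V → E x v ≡ true → Reachable V E u v
  reachable-snoc (_ , p) x∈V e = _ , snoc p x∈V e

  reachable-trans : ∀ {u x v} → Reachable V E u x → Reachable V E x v → Reachable V E u v
  reachable-trans p (_ , nil)          = p
  reachable-trans p (_ , snoc q x∈V e) = reachable-snoc (reachable-trans p (_ , q)) x∈V e

  reachable-sym : (∀ x y → E x y ≡ E y x) → ∀ {u v} → Reachable V E u v → v ∈ₛ V → Reachable V E v u
  reachable-sym E-sym (_ , nil) _ = _ , nil
  reachable-sym E-sym {v = v} (_ , snoc {x = x} p x∈V e) v∈V =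
    reachable-trans (_ , snoc nil v∈V (trans (E-sym v x) e)) (reachable-sym E-sym (_ , p) x∈V)

  path-vertices : ∀ {u v xs} → Path V E u v xs → v ∈ₛ V → All (_∈ₛ V) xs
  path-vertices nil            v∈V = v∈V ∷ []
  path-vertices (snoc p x∈V _) v∈V = v∈V ∷ path-vertices p x∈V

  reach⇒reachable : ∀ k u v → reach V E k u v ≡ true → Reachable V E u v
  reach⇒reachable zero u v e with ≡ᶠ⇒≡ {u = u} {v} e
  ... | refl = reachable-refl u
  reach⇒reachable (suc k) u v e with ∨-true⁻ {reach V E k u v} e
  ... | inj₁ short = reach⇒reachable k u v short
  ... | inj₂ longer with any-true⁻ _ (vertices n) longer
  ...   | x , _ , ex with ∧-true⁻ {mem V x} ex
  ...     | x∈V , rest with ∧-true⁻ {reach V E k u x} rest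
  ...       | u⇝x , e = reachable-snoc (reach⇒reachable k u x u⇝x) x∈V e

  reach-refl : ∀ k u → reach V E k u u ≡ true
  reach-refl zero    u = ≡ᶠ-refl u
  reach-refl (suc k) u = ∨-true⁺ˡ _ (reach-refl k u)

  path⇒reach : ∀ k {u v xs} → Path V E u v xs → length xs ≤ suc k → reach V E k u v ≡ true
  path⇒reach k       nil                  _       = reach-refl k _
  path⇒reach zero    (snoc nil _ _)        (s≤s ())
  path⇒reach zero    (snoc (snoc _ _ _) _ _) (s≤s ())
  path⇒reach (suc k) {u} {v} (snoc {x = x} p x∈V e) (s≤s l) =
    ∨-true⁺ʳ (reach V E k u v)
      (any-true⁺ _ (vertices n) (∈-allFin x) (cong₂ _∧_ x∈V (cong₂ _∧_ (path⇒reach k p l) e)))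

  private
    truncate : ∀ {u x v ys} → Path V E u x ys → Unique ys → v ∈ ys → ∃[ zs ] Path V E u v zs × Unique zs
    truncate nil            uniq       (here refl) = _ , nil , uniq
    truncate (snoc p x∈V e) uniq       (here refl) = _ , snoc p x∈V e , uniq
    truncate (snoc p _ _)   (_ ∷ uniq) (there i)   = truncate p uniq i

  path-simplify : ∀ {u v xs} → Path V E u v xs → ∃[ ys ] Path V E u v ys × Unique ys
  path-simplify nil = _ , nil , ([] ∷ [])
  path-simplify {v = v} (snoc p x∈V e) with path-simplify p
  ... | ys , q , uniq with DecMembership._∈?_ _≟_ v ys
  ...   | no  v∉ys = _ , snoc q x∈V e , (¬Any⇒All¬ ys v∉ys ∷ uniq)
  ...   | yes v∈ys = truncate q uniq v∈ys

  reachable⇒reach : ∀ {u v} → Reachable V E u v → reach V E n u v ≡ true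
  reachable⇒reach (_ , p) with path-simplify p
  ... | ys , q , uniq = path⇒reach n q
    (≤-trans (unique-length≤∣S∣ fullSet ys uniq (All.universal ∈ₛ-fullSet ys)) (m≤n⇒m≤1+n (∣p∣≤n fullSet)))

path-mono : {V V′ : Subset n} {E E′ : Fin n → Fin n → Bool}
          → (∀ x y → x ∈ₛ V → E x y ≡ true → E′ x y ≡ true) → V ⊆ₛ V′
          → ∀ {u v xs} → Path V E u v xs → Path V′ E′ u v xs
path-mono E⊆E′ V⊆V′ nil            = nil
path-mono E⊆E′ V⊆V′ (snoc p x∈V e) = snoc (path-mono E⊆E′ V⊆V′ p) (V⊆V′ _ x∈V) (E⊆E′ _ _ x∈V e)

-- Counting components by their leaders

indicator : Bool → ℕ
indicator true  = 1
indicator false = 0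

count : (A → Bool) → List A → ℕ
count p xs = length (filterᵇ p xs)

count-∷ : ∀ (p : A → Bool) x xs → count p (x ∷ xs) ≡ indicator (p x) + count p xs
count-∷ p x xs with p x
... | true  = refl
... | false = refl

count≡0 : ∀ (p : A → Bool) xs → (∀ x → x ∈ xs → p x ≡ false) → count p xs ≡ 0
count≡0 p []       _ = refl
count≡0 p (x ∷ xs) h rewrite count-∷ p x xs | h x (here refl) = count≡0 p xs (λ y i → h y (there i))

count≥1 : ∀ (p : A → Bool) {a} xs → a ∈ xs → p a ≡ true → 1 ≤ count p xs
count≥1 p (x ∷ xs) (here refl) pa rewrite count-∷ p x xs | pa = s≤s z≤n
count≥1 p (x ∷ xs) (there i)   pa rewrite count-∷ p x xs with p x
... | true  = s≤s z≤n
... | false = count≥1 p xs i pa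

count≥2 : ∀ (p : A → Bool) {a b} xs → a ∈ xs → b ∈ xs → ¬ a ≡ b → p a ≡ true → p b ≡ true → 2 ≤ count p xs
count≥2 p (x ∷ xs) (here refl) (here refl) a≢b _  _  = ⊥-elim (a≢b refl)
count≥2 p (x ∷ xs) (here refl) (there j)   _   pa pb rewrite count-∷ p x xs | pa = s≤s (count≥1 p xs j pb)
count≥2 p (x ∷ xs) (there i)   (here refl) _   pa pb rewrite count-∷ p x xs | pb = s≤s (count≥1 p xs i pa)
count≥2 p (x ∷ xs) (there i)   (there j)   a≢b pa pb rewrite count-∷ p x xs with p x
... | true  = ≤-trans (count≥2 p xs i j a≢b pa pb) (n≤1+n _)
... | false = count≥2 p xs i j a≢b pa pb

count≡1 : ∀ (p : A → Bool) {a} xs → Unique xs → a ∈ xs → p a ≡ true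
        → (∀ b → b ∈ xs → p b ≡ true → b ≡ a) → count p xs ≡ 1
count≡1 p (x ∷ xs) (x∉xs ∷ uniq) i pa only-a rewrite count-∷ p x xs with p x in px
... | true = cong suc (count≡0 p xs none)
  where
  none : ∀ b → b ∈ xs → p b ≡ false
  none b j = ≢true⇒≡false λ pb →
    All.lookup x∉xs j (trans (only-a x (here refl) px) (sym (only-a b (there j) pb)))
... | false with i
...   | here refl = ⊥-elim (true≢false (trans (sym pa) px))
...   | there j   = count≡1 p xs uniq j pa (λ b k pb → only-a b (there k) pb)

sumOver : (A → ℕ) → List A → ℕ
sumOver f = foldr (λ x acc → f x + acc) 0

count≡sumOver : ∀ (p : A → Bool) xs → count p xs ≡ sumOver (indicator ∘′ p) xs
count≡sumOver p []       = refl
count≡sumOver p (x ∷ xs) rewrite count-∷ p x xs = cong (indicator (p x) +_) (count≡sumOver p xs)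

sumOver-+ : ∀ (f g : A → ℕ) xs → sumOver (λ x → f x + g x) xs ≡ sumOver f xs + sumOver g xs
sumOver-+ f g []       = refl
sumOver-+ f g (x ∷ xs) rewrite sumOver-+ f g xs =
  solve 4 (λ a b c d → (a :+ b) :+ (c :+ d) := (a :+ c) :+ (b :+ d)) refl (f x) (g x) (sumOver f xs) (sumOver g xs)
  where open +-*-Solver

sumOver-0 : ∀ (xs : List A) → sumOver (λ _ → 0) xs ≡ 0
sumOver-0 []       = refl
sumOver-0 (_ ∷ xs) = sumOver-0 xs

sumOver-cong : ∀ (f g : A → ℕ) xs → (∀ x → x ∈ xs → f x ≡ g x) → sumOver f xs ≡ sumOver g xs
sumOver-cong f g []       _ = refl
sumOver-cong f g (x ∷ xs) h = cong₂ _+_ (h x (here refl)) (sumOver-cong f g xs (λ y i → h y (there i)))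

least-witness : (p : Fin n → Bool) (v : Fin n) → p v ≡ true
              → ∃[ μ ] p μ ≡ true × (∀ u → p u ≡ true → toℕ μ ≤ toℕ u)
least-witness {suc n} p v pv with p fzero in p0
... | true  = fzero , p0 , (λ _ _ → z≤n)
... | false with v
...   | fzero   = ⊥-elim (true≢false (trans (sym pv) p0))
...   | fsuc v′ with least-witness (λ u → p (fsuc u)) v′ pv
...     | μ , pμ , least = fsuc μ , pμ , least′
  where
  least′ : ∀ u → p u ≡ true → toℕ (fsuc μ) ≤ toℕ u
  least′ fzero    pu = ⊥-elim (true≢false (trans (sym pu) p0))
  least′ (fsuc u) pu = s≤s (least u pu)

isLeader : Subset n → (Fin n → Fin n → Bool) → Fin n → Bool
isLeader {n} V E v = mem V v ∧ not (any (λ u → mem V u ∧ (toℕ u <ᵇ toℕ v) ∧ reach V E n u v) (vertices n))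

components≡count-isLeader : (V : Subset n) (E : Fin n → Fin n → Bool) → components V E ≡ count (isLeader V E) (vertices n)
components≡count-isLeader V E = refl

∉ₛ⇒¬isLeader : (V : Subset n) (E : Fin n → Fin n → Bool) {v : Fin n} → v ∉ₛ V → isLeader V E v ≡ false
∉ₛ⇒¬isLeader V E v∉V rewrite v∉V = refl

module _ {V : Subset n} {E : Fin n → Fin n → Bool} where

  isLeader⇒∈ₛ : ∀ {v} → isLeader V E v ≡ true → v ∈ₛ V
  isLeader⇒∈ₛ {v} e = proj₁ (∧-true⁻ {mem V v} e)

  isLeader-least : ∀ {u v} → isLeader V E v ≡ true → u ∈ₛ V → toℕ u < toℕ v → ¬ Reachable V E u v
  isLeader-least {u} {v} leader u∈V u<v u⇝v =
    true≢false (trans (sym (any-true⁺ _ (vertices n) (∈-allFin u) smaller))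
                      (not-injective (proj₂ (∧-true⁻ {mem V v} leader))))
    where
    smaller = cong₂ _∧_ u∈V (cong₂ _∧_ (Equivalence.to T-≡ (<⇒<ᵇ u<v)) (reachable⇒reach u⇝v))

  module _ (E-sym : ∀ x y → E x y ≡ E y x) where

    leader-exists : ∀ s → s ∈ₛ V → ∃[ ℓ ] isLeader V E ℓ ≡ true × Reachable V E ℓ s
    leader-exists s s∈V with least-witness (λ u → mem V u ∧ reach V E n u s) s (cong₂ _∧_ s∈V (reach-refl n s))
    ... | μ , pμ , least with ∧-true⁻ {mem V μ} pμ
    ...   | μ∈V , μ⇝s = μ , cong₂ _∧_ μ∈V (cong not (≢true⇒≡false noSmaller)) , reach⇒reachable n μ s μ⇝s
      where
      noSmaller : ¬ any (λ u → mem V u ∧ (toℕ u <ᵇ toℕ μ) ∧ reach V E n u μ) (vertices n) ≡ true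
      noSmaller smaller with any-true⁻ _ (vertices n) smaller
      ... | u , _ , eu with ∧-true⁻ {mem V u} eu
      ...   | u∈V , rest with ∧-true⁻ {toℕ u <ᵇ toℕ μ} rest
      ...     | u<μ , u⇝μ =
        ≤⇒≯ (least u (cong₂ _∧_ u∈V (reachable⇒reach (reachable-trans (reach⇒reachable n u μ u⇝μ)
                                                                        (reach⇒reachable n μ s μ⇝s)))))
            (<ᵇ⇒< (toℕ u) (toℕ μ) (Equivalence.from T-≡ u<μ))

    components≡1⇒reachable : components V E ≡ 1 → ∀ {x y} → x ∈ₛ V → y ∈ₛ V → Reachable V E x y
    components≡1⇒reachable one {x} {y} x∈V y∈V with leader-exists x x∈V | leader-exists y y∈V
    ... | ℓx , ℓx-leader , ℓx⇝x | ℓy , ℓy-leader , ℓy⇝y with ℓx ≟ ℓy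
    ...   | yes refl = reachable-trans (reachable-sym E-sym ℓx⇝x x∈V) ℓy⇝y
    ...   | no  ℓx≢ℓy = ⊥-elim (≤⇒≯ (subst (2 ≤_) one twoLeaders) (s≤s (s≤s z≤n)))
      where
      twoLeaders = count≥2 (isLeader V E) (vertices n) (∈-allFin ℓx) (∈-allFin ℓy) ℓx≢ℓy ℓx-leader ℓy-leader

    reachable⇒components≡1 : ∀ {r} → r ∈ₛ V → (∀ s → s ∈ₛ V → Reachable V E r s) → components V E ≡ 1
    reachable⇒components≡1 {r} r∈V r⇝ with leader-exists r r∈V
    ... | ℓ , ℓ-leader , _ = count≡1 (isLeader V E) (vertices n) (allFin⁺ n) (∈-allFin ℓ) ℓ-leader onlyℓ
      where
      connected : ∀ {a b} → a ∈ₛ V → b ∈ₛ V → Reachable V E a b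
      connected a∈V b∈V = reachable-trans (reachable-sym E-sym (r⇝ _ a∈V) a∈V) (r⇝ _ b∈V)
      ℓ∈V = isLeader⇒∈ₛ ℓ-leader
      onlyℓ : ∀ b → b ∈ vertices n → isLeader V E b ≡ true → b ≡ ℓ
      onlyℓ b _ b-leader with b∈V ← isLeader⇒∈ₛ b-leader | <-cmp (toℕ b) (toℕ ℓ)
      ... | tri< b<ℓ _ _ = ⊥-elim (isLeader-least ℓ-leader b∈V b<ℓ (connected b∈V ℓ∈V))
      ... | tri≈ _ b≡ℓ _ = toℕ-injective b≡ℓ
      ... | tri> _ _ ℓ<b = ⊥-elim (isLeader-least b-leader ℓ∈V ℓ<b (connected ℓ∈V b∈V))

-- Flags and their blocks

data Chain {n} : Subset n → Flag n → Set where
  top  : ∀ {P} → (∀ i → i ∈ₛ P) → Chain P []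
  step : ∀ {P F Fs} → P ⊆ₛ F → Chain F Fs → Chain P (F ∷ Fs)

chainsFrom⇒Chain : ∀ fuel (S : Subset n) {Fs} → Fs ∈ chainsFrom fuel S → Chain S Fs
chainsFrom⇒Chain {n} fuel S i with ∣ S ∣ ≡ᵇ n in full
chainsFrom⇒Chain         fuel    S (here refl) | true  = top (∣S∣≡n⇒∈ₛS S (≡ᵇ⇒≡ _ _ (Equivalence.from T-≡ full)))
chainsFrom⇒Chain         zero    S ()          | false
chainsFrom⇒Chain {n}     (suc f) S i           | false
  with ∈-concat⁻′ (map (λ T → map (T ∷_) (chainsFrom f T)) (filterᵇ (λ T → S ⊂ᵇ T) (subsets n))) i
... | _ , i₁ , i₂ with ∈-map⁻ (λ T → map (T ∷_) (chainsFrom f T)) i₂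
...   | T , T∈ , refl with ∈-map⁻ (T ∷_) i₁
...     | _ , Fs∈ , refl =
  step (⊆ᵇ⇒⊆ₛ S T (proj₁ (∧-true⁻ {S ⊆ᵇ T} (proj₂ (∈-filterᵇ⁻ _ (subsets n) T∈))))) (chainsFrom⇒Chain f T Fs∈)

allFlags⇒Chain : ∀ {Fs} → Fs ∈ allFlags n → Chain emptySet Fs
allFlags⇒Chain {n} i = chainsFrom⇒Chain n emptySet (proj₁ (∈-filterᵇ⁻ (λ F → not (null F)) _ i))

-- A block (P , F) of a flag is a pair of consecutive members; its vertices are F ∖ P.
Block : ℕ → Set
Block n = Subset n × Subset n

blocks : Subset n → Flag n → List (Block n)
blocks P []       = []
blocks P (F ∷ Fs) = (P , F) ∷ blocks F Fs

∈-quotFrom⁻ : (H : Hypergraph n) (P : Subset n) (Fs : Flag n) {h′ : Subset n} → h′ ∈ quotFrom H P Fs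
            → ∃[ b ] b ∈ blocks P Fs × ∃[ h ] h ∈ H × h ⊆ₛ proj₂ b × h′ ≡ h ∖ᵇ proj₁ b
∈-quotFrom⁻ H P (F ∷ Fs) i with ∈-++⁻ (contractH (restrictH H F) P) i
... | inj₁ i₁ with ∈-map⁻ (_∖ᵇ P) i₁
...   | h , h∈ , refl with ∈-filterᵇ⁻ (_⊆ᵇ F) H h∈
...     | h∈H , h⊆F = (P , F) , here refl , h , h∈H , ⊆ᵇ⇒⊆ₛ h F h⊆F , refl
∈-quotFrom⁻ H P (F ∷ Fs) i | inj₂ i₂ with ∈-quotFrom⁻ H F Fs i₂
... | b , b∈ , rest = b , there b∈ , rest

∈-quotFrom⁺ : (H : Hypergraph n) (P : Subset n) (Fs : Flag n) {b : Block n} {h : Subset n}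
            → b ∈ blocks P Fs → h ∈ H → h ⊆ₛ proj₂ b → h ∖ᵇ proj₁ b ∈ quotFrom H P Fs
∈-quotFrom⁺ H P (F ∷ Fs) {h = h} (here refl) h∈H h⊆F =
  ∈-++⁺ˡ (∈-map⁺ (_∖ᵇ P) (∈-filterᵇ⁺ (_⊆ᵇ F) H h∈H (⊆ₛ⇒⊆ᵇ h F h⊆F)))
∈-quotFrom⁺ H P (F ∷ Fs) (there b∈) h∈H h⊆F = ∈-++⁺ʳ (contractH (restrictH H F) P) (∈-quotFrom⁺ H F Fs b∈ h∈H h⊆F)

private
  ⊆-later-blocks : ∀ {F : Subset n} {Fs b} → Chain F Fs → b ∈ blocks F Fs → F ⊆ₛ proj₁ b
  ⊆-later-blocks (step _ _)   (here refl) i i∈F = i∈F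
  ⊆-later-blocks (step F⊆ c) (there b∈)  i i∈F = ⊆-later-blocks c b∈ i (F⊆ i i∈F)

blocks-disjoint : ∀ {P : Subset n} {Fs b₁ b₂ y} → Chain P Fs → b₁ ∈ blocks P Fs → b₂ ∈ blocks P Fs
                → y ∈ₛ proj₂ b₁ × y ∉ₛ proj₁ b₁ → y ∈ₛ proj₂ b₂ × y ∉ₛ proj₁ b₂ → b₁ ≡ b₂
blocks-disjoint (step _ _) (here refl) (here refl) _ _ = refl
blocks-disjoint {y = y} (step _ c) (here refl) (there j) (y∈F , _) (_ , y∉P) =
  ⊥-elim (true≢false (trans (sym (⊆-later-blocks c j y y∈F)) y∉P))
blocks-disjoint {y = y} (step _ c) (there i) (here refl) (_ , y∉P) (y∈F , _) =
  ⊥-elim (true≢false (trans (sym (⊆-later-blocks c i y y∈F)) y∉P))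
blocks-disjoint (step _ c) (there i) (there j) y∈₁ y∈₂ = blocks-disjoint c i j y∈₁ y∈₂

is-just⇒just : ∀ {r : Maybe A} → is-just r ≡ true → ∃[ a ] r ≡ just a
is-just⇒just {r = just a} _ = a , refl

AtMost : Maybe ℕ → ℕ → Set
AtMost r a = ∃[ b ] r ≡ just b × b ≤ a

minM-atMostˡ : ∀ {x a} y → AtMost x a → AtMost (minM x y) a
minM-atMostˡ nothing  (b , refl , b≤a) = b , refl , b≤a
minM-atMostˡ (just c) (b , refl , b≤a) = _ , refl , ≤-trans (m⊓n≤m b c) b≤a

minM-atMostʳ : ∀ x {y a} → AtMost y a → AtMost (minM x y) a
minM-atMostʳ nothing  y≤a              = y≤a
minM-atMostʳ (just c) (b , refl , b≤a) = _ , refl , ≤-trans (m⊓n≤n c b) b≤a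

foldr-minM-atMost : ∀ (f : A → Maybe ℕ) {x a} xs → x ∈ xs → AtMost (f x) a → AtMost (foldr minM nothing (map f xs)) a
foldr-minM-atMost f (y ∷ ys) (here refl) fx≤a = minM-atMostˡ _ fx≤a
foldr-minM-atMost f (y ∷ ys) (there i)   fx≤a = minM-atMostʳ (f y) (foldr-minM-atMost f ys i fx≤a)

minM≡just⁻ : ∀ x y {w} → minM x y ≡ just w → x ≡ just w ⊎ y ≡ just w
minM≡just⁻ nothing  y        e = inj₂ e
minM≡just⁻ (just a) nothing  e = inj₁ e
minM≡just⁻ (just a) (just b) e with ⊓-sel a b
... | inj₁ a⊓b≡a = inj₁ (trans (cong just (sym a⊓b≡a)) e)
... | inj₂ a⊓b≡b = inj₂ (trans (cong just (sym a⊓b≡b)) e)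

foldr-minM≡just⁻ : ∀ (f : A → Maybe ℕ) xs {w} → foldr minM nothing (map f xs) ≡ just w → ∃[ x ] x ∈ xs × f x ≡ just w
foldr-minM≡just⁻ f (y ∷ ys) e with minM≡just⁻ (f y) _ e
... | inj₁ fy = y , here refl , fy
... | inj₂ rest with foldr-minM≡just⁻ f ys rest
...   | x , i , fx = x , there i , fx

addM≡just⁻ : ∀ x y {w} → addM x y ≡ just w → ∃[ a ] ∃[ b ] x ≡ just a × y ≡ just b × w ≡ a + b
addM≡just⁻ (just a) (just b) refl = a , b , refl , refl , refl

pathMin-atMost-dec : ∀ (G : DGraph n) I u v {c} → AtMost (dec G u v) c → ∀ k → AtMost (pathMin G I k u v) c
pathMin-atMost-dec G I u v d≤c zero    = d≤c
pathMin-atMost-dec G I u v d≤c (suc k) = minM-atMostˡ _ (pathMin-atMost-dec G I u v d≤c k)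

-- The block graphs pr_m(Γ¹|F / P)

module _ (Γ : SimpleGraph n) (m : ℕ) where

  induced : Subset n → DGraph n
  induced F = restrictD (Γ¹ Γ) F

  inducedAdj : Subset n → Fin n → Fin n → Bool
  inducedAdj F u v = is-just (dec (induced F) u v)

  interior : Subset n → Subset n → Subset n
  interior P F = verts (induced F) ∩ᵇ P

  blockGraph : Subset n → Subset n → DGraph n
  blockGraph P F = prD m (contractD (induced F) P)

  blockVerts : Subset n → Subset n → Subset n
  blockVerts P F = verts (blockGraph P F)

  blockAdj : Subset n → Subset n → Fin n → Fin n → Bool
  blockAdj P F u v = is-just (dec (blockGraph P F) u v)

  mem-induced : ∀ F i → mem (verts (induced F)) i ≡ mem F i
  mem-induced F i rewrite mem-∩ᵇ fullSet F i | ∈ₛ-fullSet i = refl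

  mem-blockVerts : ∀ P F i → mem (blockVerts P F) i ≡ (mem F i ∧ not (mem P i))
  mem-blockVerts P F i rewrite mem-∖ᵇ (fullSet ∩ᵇ F) P i | mem-induced F i = refl

  ∈-blockVerts⁺ : ∀ P F {i} → i ∈ₛ F → i ∉ₛ P → i ∈ₛ blockVerts P F
  ∈-blockVerts⁺ P F {i} i∈F i∉P rewrite mem-blockVerts P F i | i∈F | i∉P = refl

  ∈-blockVerts⁻ : ∀ P F {i} → i ∈ₛ blockVerts P F → i ∈ₛ F × i ∉ₛ P
  ∈-blockVerts⁻ P F {i} e rewrite mem-blockVerts P F i with mem F i | mem P i | e
  ... | true | false | _ = refl , refl

  ∈-interior⁺ : ∀ P F {i} → i ∈ₛ F → i ∈ₛ P → i ∈ₛ interior P F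
  ∈-interior⁺ P F {i} i∈F i∈P rewrite mem-∩ᵇ (fullSet ∩ᵇ F) P i | mem-induced F i | i∈F | i∈P = refl

  dec-induced⁺ : ∀ F {u v} → u ∈ₛ F → v ∈ₛ F → adj Γ u v ≡ true → dec (induced F) u v ≡ just 1
  dec-induced⁺ F {u} {v} u∈F v∈F uv rewrite mem-induced F u | mem-induced F v | u∈F | v∈F | uv = refl

  dec-induced⁻ : ∀ F {u v w} → dec (induced F) u v ≡ just w → w ≡ 1 × u ∈ₛ F × v ∈ₛ F × adj Γ u v ≡ true
  dec-induced⁻ F {u} {v} e rewrite mem-induced F u | mem-induced F v with mem F u | mem F v | adj Γ u v | e
  ... | true | true | true | refl = refl , refl , refl , refl

  inducedAdj⁺ : ∀ F {u v} → u ∈ₛ F → v ∈ₛ F → adj Γ u v ≡ true → inducedAdj F u v ≡ true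
  inducedAdj⁺ F u∈F v∈F uv rewrite dec-induced⁺ F u∈F v∈F uv = refl

  blockAdj⁻ : ∀ P F {u v} → blockAdj P F u v ≡ true
            → ∃[ w ] pathMin (induced F) (interior P F) n u v ≡ just w × w ≤ m
                     × u ∈ₛ blockVerts P F × v ∈ₛ blockVerts P F
  blockAdj⁻ P F {u} {v} e
    with mem (blockVerts P F) u | mem (blockVerts P F) v | u ≡ᶠ v | pathMin (induced F) (interior P F) n u v
  ... | true  | true  | false | just w with w ≤ᵇ m in w≤m
  ...   | true = w , refl , ≤ᵇ⇒≤ w m (Equivalence.from T-≡ w≤m) , refl , refl
  blockAdj⁻ P F () | true  | true  | false | just w | false
  blockAdj⁻ P F () | true  | true  | false | nothing
  blockAdj⁻ P F () | true  | true  | true  | _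
  blockAdj⁻ P F () | true  | false | _     | _
  blockAdj⁻ P F () | false | _     | _     | _

  blockAdj⁺ : ∀ P F {u v w} → u ∈ₛ blockVerts P F → v ∈ₛ blockVerts P F → ¬ u ≡ v
            → pathMin (induced F) (interior P F) n u v ≡ just w → w ≤ m → blockAdj P F u v ≡ true
  blockAdj⁺ P F u∈ v∈ u≢v e w≤m rewrite u∈ | v∈ | ≢⇒≡ᶠ-false u≢v | e | Equivalence.to T-≡ (≤⇒≤ᵇ w≤m) = refl

  -- xs lists the vertices after a, so the walk a → x₁ ⇝ z has exactly length xs edges.
  pathMin-atMost-walk : ∀ P F {a x₁ z xs} k → dec (induced F) a x₁ ≡ just 1
                      → Path (interior P F) (inducedAdj F) x₁ z xs → length xs ≤ suc k
                      → AtMost (pathMin (induced F) (interior P F) k a z) (length xs)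
  pathMin-atMost-walk P F k       ax₁ nil _ =
    pathMin-atMost-dec (induced F) (interior P F) _ _ (1 , ax₁ , ≤-refl) k
  pathMin-atMost-walk P F zero    _ (snoc nil _ _)          (s≤s ())
  pathMin-atMost-walk P F zero    _ (snoc (snoc _ _ _) _ _) (s≤s ())
  pathMin-atMost-walk P F {a} {z = z} (suc k) ax₁ (snoc {x = x} {xs = xs} p x∈I xz) (s≤s l) =
    minM-atMostʳ (pathMin (induced F) (interior P F) k a z) (foldr-minM-atMost _ (vertices n) (∈-allFin x) viaX)
    where
    viaX : AtMost (if mem (interior P F) x then addM (pathMin (induced F) (interior P F) k a x) (dec (induced F) x z)
                                             else nothing)
                  (suc (length xs))
    viaX with pathMin-atMost-walk P F k ax₁ p l | is-just⇒just xz
    ... | b , eb , b≤ | _ , exz rewrite x∈I | eb | exz | proj₁ (dec-induced⁻ F exz) =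
      b + 1 , refl , subst (b + 1 ≤_) (+-comm (length xs) 1) (+-monoˡ-≤ 1 b≤)

  record SmallConnectedSet (F : Subset n) (u v : Fin n) (w : ℕ) : Set where
    field
      S         : Subset n
      u∈S       : u ∈ₛ S
      v∈S       : v ∈ₛ S
      S⊆F       : S ⊆ₛ F
      ∣S∣≤1+w   : ∣ S ∣ ≤ suc w
      reachable : ∀ s → s ∈ₛ S → Reachable S (adj Γ) u s

  smallConnectedSet-refl : ∀ {F u} → u ∈ₛ F → SmallConnectedSet F u u 0
  smallConnectedSet-refl {F} {u} u∈F = record
    { S = ⁅ u ⁆ ; u∈S = x∈ₛ⁅x⁆ u ; v∈S = x∈ₛ⁅x⁆ u
    ; S⊆F = λ i i∈ → subst (_∈ₛ F) (sym (x∈ₛ⁅y⁆⇒x≡y u i∈)) u∈F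
    ; ∣S∣≤1+w = ≤-reflexive (∣⁅x⁆∣≡1 u)
    ; reachable = λ s s∈ → subst (Reachable ⁅ u ⁆ (adj Γ) u) (sym (x∈ₛ⁅y⁆⇒x≡y u s∈)) (reachable-refl u) }

  smallConnectedSet-snoc : ∀ {F u x v a} → SmallConnectedSet F u x a → v ∈ₛ F → adj Γ x v ≡ true
                         → SmallConnectedSet F u v (a + 1)
  smallConnectedSet-snoc {F} {u} {x} {v} {a} C v∈F xv = record
    { S = S ∪ ⁅ v ⁆
    ; u∈S = grow _ u∈S
    ; v∈S = ∈ₛ-∪⁺ S ⁅ v ⁆ (inj₂ (x∈ₛ⁅x⁆ v))
    ; S⊆F = S′⊆F
    ; ∣S∣≤1+w = ≤-trans (∣p∪q∣≤∣p∣+∣q∣ S ⁅ v ⁆)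
                        (subst (λ t → ∣ S ∣ + t ≤ suc (a + 1)) (sym (∣⁅x⁆∣≡1 v)) (+-monoˡ-≤ 1 ∣S∣≤1+w))
    ; reachable = reachable′ }
    where
    open SmallConnectedSet C
    grow : S ⊆ₛ S ∪ ⁅ v ⁆
    grow i i∈S = ∈ₛ-∪⁺ S ⁅ v ⁆ (inj₁ i∈S)
    S′⊆F : S ∪ ⁅ v ⁆ ⊆ₛ F
    S′⊆F i i∈ with ∈ₛ-∪⁻ S ⁅ v ⁆ i∈
    ... | inj₁ i∈S = S⊆F i i∈S
    ... | inj₂ i∈v rewrite x∈ₛ⁅y⁆⇒x≡y v i∈v = v∈F
    lift : ∀ {s} → Reachable S (adj Γ) u s → Reachable (S ∪ ⁅ v ⁆) (adj Γ) u s
    lift (_ , p) = _ , path-mono (λ _ _ _ e → e) grow p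
    reachable′ : ∀ s → s ∈ₛ S ∪ ⁅ v ⁆ → Reachable (S ∪ ⁅ v ⁆) (adj Γ) u s
    reachable′ s s∈ with ∈ₛ-∪⁻ S ⁅ v ⁆ s∈
    ... | inj₁ s∈S = lift (reachable s s∈S)
    ... | inj₂ s∈v rewrite x∈ₛ⁅y⁆⇒x≡y v s∈v = reachable-snoc (lift (reachable x v∈S)) (grow x v∈S) xv

  -- S is the vertex set of a walk realising the minimum.
  pathMin-smallConnectedSet : ∀ P F k {u v w} → pathMin (induced F) (interior P F) k u v ≡ just w
                            → SmallConnectedSet F u v w
  pathMin-smallConnectedSet P F zero e with dec-induced⁻ F e
  ... | refl , u∈F , v∈F , uv = smallConnectedSet-snoc (smallConnectedSet-refl u∈F) v∈F uv
  pathMin-smallConnectedSet P F (suc k) {u} {v} e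
    with minM≡just⁻ (pathMin (induced F) (interior P F) k u v) _ e
  ... | inj₁ shorter = pathMin-smallConnectedSet P F k shorter
  ... | inj₂ viaSome
    with foldr-minM≡just⁻ (λ x → if mem (interior P F) x
                                  then addM (pathMin (induced F) (interior P F) k u x) (dec (induced F) x v)
                                  else nothing)
                         (vertices n) viaSome
  ...   | x , _ , viaX with mem (interior P F) x
  ...     | true with addM≡just⁻ (pathMin (induced F) (interior P F) k u x) (dec (induced F) x v) viaX
  ...       | a , b , ua , xv , refl with dec-induced⁻ F xv
  ...         | refl , _ , v∈F , adj-xv = smallConnectedSet-snoc (pathMin-smallConnectedSet P F k ua) v∈F adj-xv

  module _ (P F h : Subset n) (h⊆F : h ⊆ₛ F) (∣h∣≤1+m : ∣ h ∣ ≤ suc m) where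

    private
      Excursion : Fin n → Fin n → List (Fin n) → Set
      Excursion a z zs = ∃[ x₁ ] dec (induced F) a x₁ ≡ just 1 × Path (interior P F) (inducedAdj F) x₁ z zs

      Segment : Fin n → Fin n → List (Fin n) → Set
      Segment a z zs = (zs ≡ [] × z ≡ a) ⊎ (Excursion a z zs × z ∈ₛ P)

      -- Invariant while walking along a simple path x ⇝ z inside h: the anchor is the last vertex
      -- outside P seen so far, already reached from x in the block graph, and the vertices after it
      -- (all in P, except possibly z = anchor) form a segment.
      record Progress (x z : Fin n) (ys : List (Fin n)) : Set where
        constructor mkProgress
        field
          anchor    : Fin n
          tail rest : List (Fin n)
          split     : ys ≡ tail ++ anchor ∷ rest
          anchor∈   : anchor ∈ₛ blockVerts P F
          x⇝anchor  : Reachable (blockVerts P F) (blockAdj P F) x anchor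
          segment   : Segment anchor z tail

      extend-segment : ∀ {a z z′ zs} → z ∈ₛ h → z′ ∈ₛ h → adj Γ z z′ ≡ true → Segment a z zs → Excursion a z′ (z′ ∷ zs)
      extend-segment z∈h z′∈h zz′ (inj₁ (refl , refl)) = _ , dec-induced⁺ F (h⊆F _ z∈h) (h⊆F _ z′∈h) zz′ , nil
      extend-segment {z = z} z∈h z′∈h zz′ (inj₂ ((x₁ , ax₁ , q) , z∈P)) =
        x₁ , ax₁ , snoc q (∈-interior⁺ P F (h⊆F z z∈h) z∈P) (inducedAdj⁺ F (h⊆F _ z∈h) (h⊆F _ z′∈h) zz′)

      progress : ∀ {x z ys} → x ∈ₛ blockVerts P F → Path h (adj Γ) x z ys → Unique ys → z ∈ₛ h → Progress x z ys
      progress x∈ nil _ _ = mkProgress _ [] [] refl x∈ (reachable-refl _) (inj₁ (refl , refl))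
      progress x∈ (snoc {x = z} {v = z′} p z∈h zz′) (z′∉ ∷ uniq) z′∈h with progress x∈ p uniq z∈h
      ... | mkProgress a zs rest refl a∈ x⇝a seg with mem P z′ in z′∈P?
      ...   | true  = mkProgress a (z′ ∷ zs) rest refl a∈ x⇝a (inj₂ (extend-segment z∈h z′∈h zz′ seg , z′∈P?))
      ...   | false = mkProgress z′ [] (zs ++ a ∷ rest) refl z′∈ (reachable-snoc x⇝a a∈ a-z′) (inj₁ (refl , refl))
        where
        z′∈ = ∈-blockVerts⁺ P F (h⊆F _ z′∈h) z′∈P?
        -- the excursion a ⇝ z′ visits distinct vertices of h, so it has at most ∣ h ∣ - 1 ≤ m edges
        bound : suc (length (z′ ∷ zs)) ≤ ∣ h ∣
        bound = ≤-trans (s≤s (prefix-length< zs a rest))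
                        (unique-length≤∣S∣ h _ (z′∉ ∷ uniq) (path-vertices (snoc p z∈h zz′) z′∈h))
        a≢z′ : ¬ a ≡ z′
        a≢z′ a≡z′ = All.lookup z′∉ (∈-++⁺ʳ zs (here refl)) (sym a≡z′)
        a-z′ : blockAdj P F a z′ ≡ true
        a-z′ with x₁ , ax₁ , q ← extend-segment z∈h z′∈h zz′ seg
                | pathMin-atMost-walk P F n ax₁ q (≤-trans (n≤1+n _) (≤-trans bound (m≤n⇒m≤1+n (∣p∣≤n h))))
        ... | b , eb , b≤ = blockAdj⁺ P F a∈ z′∈ a≢z′ eb (≤-trans b≤ (≤-pred (≤-trans bound ∣h∣≤1+m)))

    hyperedge⇒blockReachable : ∀ {x y} → components h (adj Γ) ≡ 1 → x ∈ₛ h → y ∈ₛ h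
                             → x ∈ₛ blockVerts P F → y ∈ₛ blockVerts P F
                             → Reachable (blockVerts P F) (blockAdj P F) x y
    hyperedge⇒blockReachable connected x∈h y∈h x∈ y∈
      with _ , q , uniq ← path-simplify (proj₂ (components≡1⇒reachable (adj-sym Γ) connected x∈h y∈h))
      with progress x∈ q uniq y∈h
    ... | mkProgress _ _ _ _ _ x⇝a (inj₁ (refl , refl)) = x⇝a
    ... | mkProgress _ _ _ _ _ _   (inj₂ (_ , y∈P))     =
      ⊥-elim (true≢false (trans (sym y∈P) (proj₂ (∈-blockVerts⁻ P F y∈))))

  -- Comparing H_m(Γ)/𝓕 with the block graphs

  ∈-Hm⁻ : ∀ {h} → h ∈ Hm m Γ → ∣ h ∣ ≤ suc m × components h (adj Γ) ≡ 1
  ∈-Hm⁻ {h} h∈ with ∧-true⁻ {∣ h ∣ ≤ᵇ suc m} (proj₂ (∈-filterᵇ⁻ _ (subsets n) h∈))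
  ... | small , connected = ≤ᵇ⇒≤ _ _ (Equivalence.from T-≡ small) , ≡ᵇ⇒≡ _ _ (Equivalence.from T-≡ connected)

  ∈-Hm⁺ : ∀ S → ∣ S ∣ ≤ suc m → components S (adj Γ) ≡ 1 → S ∈ Hm m Γ
  ∈-Hm⁺ S small connected = ∈-filterᵇ⁺ _ (subsets n) (∈-subsets S)
    (cong₂ _∧_ (Equivalence.to T-≡ (≤⇒≤ᵇ small)) (Equivalence.to T-≡ (≡⇒≡ᵇ _ _ connected)))

  blockLeaders : Fin n → Subset n → Flag n → ℕ
  blockLeaders v P []       = 0
  blockLeaders v P (F ∷ Fs) = indicator (isLeader (blockVerts P F) (blockAdj P F) v) + blockLeaders v F Fs

  compSumFrom≡sumOver-blockLeaders : ∀ P Fs → compSumFrom m (Γ¹ Γ) P Fs ≡ sumOver (λ v → blockLeaders v P Fs) (vertices n)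
  compSumFrom≡sumOver-blockLeaders P []       = sym (sumOver-0 (vertices n))
  compSumFrom≡sumOver-blockLeaders P (F ∷ Fs) =
    trans (cong₂ _+_ (trans (components≡count-isLeader (blockVerts P F) (blockAdj P F))
                            (count≡sumOver (isLeader (blockVerts P F) (blockAdj P F)) (vertices n)))
                     (compSumFrom≡sumOver-blockLeaders F Fs))
          (sym (sumOver-+ (indicator ∘′ isLeader (blockVerts P F) (blockAdj P F)) (λ v → blockLeaders v F Fs) (vertices n)))

  blockLeaders-below : ∀ {P Fs v} → Chain P Fs → v ∈ₛ P → blockLeaders v P Fs ≡ 0
  blockLeaders-below (top _) _ = refl
  blockLeaders-below {P} {v = v} (step {F = F} P⊆F c) v∈P =
    cong₂ _+_ (cong indicator (∉ₛ⇒¬isLeader (blockVerts P F) (blockAdj P F) v∉block)) (blockLeaders-below c (P⊆F v v∈P))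
    where
    v∉block : v ∉ₛ blockVerts P F
    v∉block rewrite mem-blockVerts P F v | P⊆F v v∈P | v∈P = refl

  module _ {Fs : Flag n} (chain : Chain emptySet Fs) where

    private
      Q : Hypergraph n
      Q = quotFlag (Hm m Γ) Fs

      quotAdj : Fin n → Fin n → Bool
      quotAdj u v = any (λ h → mem h u ∧ mem h v) Q

    -- A hyperedge of H/𝓕 meeting the block (P , F) is h ∖ P for a hyperedge h ⊆ F of H_m(Γ):
    -- it cannot come from another block, since the blocks partition [n].
    quotPath⇒blockReachable : ∀ {P F} → (P , F) ∈ blocks emptySet Fs → ∀ {u y ys} → Path fullSet quotAdj u y ys
                            → y ∈ₛ blockVerts P F → u ∈ₛ blockVerts P F × Reachable (blockVerts P F) (blockAdj P F) u y
    quotPath⇒blockReachable b∈ nil y∈ = y∈ , reachable-refl _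
    quotPath⇒blockReachable {P} {F} b∈ {y = y} (snoc {x = x} p _ xy) y∈
      with h′ , h′∈Q , x,y∈h′ ← any-true⁻ _ Q xy
      with (P′ , F′) , b′∈ , h , h∈H , h⊆F′ , refl ← ∈-quotFrom⁻ (Hm m Γ) emptySet Fs h′∈Q
      with (x∈h , x∉P′) ← ∈ₛ-∖ᵇ⁻ h P′ (proj₁ (∧-true⁻ x,y∈h′))
         | (y∈h , y∉P′) ← ∈ₛ-∖ᵇ⁻ h P′ (proj₂ (∧-true⁻ {mem h′ x} x,y∈h′))
      with refl ← blocks-disjoint chain b′∈ b∈ (h⊆F′ y y∈h , y∉P′) (∈-blockVerts⁻ P F y∈)
      with (∣h∣≤1+m , h-connected) ← ∈-Hm⁻ h∈H =
      u∈ , reachable-trans u⇝x (hyperedge⇒blockReachable P F h h⊆F′ ∣h∣≤1+m h-connected x∈h y∈h x∈ y∈)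
      where
      x∈ = ∈-blockVerts⁺ P F (h⊆F′ x x∈h) x∉P′
      u∈ = proj₁ (quotPath⇒blockReachable b∈ p x∈)
      u⇝x = proj₂ (quotPath⇒blockReachable b∈ p x∈)

    blockAdj⇒quotAdj : ∀ {P F} → (P , F) ∈ blocks emptySet Fs → ∀ x y → x ∈ₛ blockVerts P F
                     → blockAdj P F x y ≡ true → quotAdj x y ≡ true
    blockAdj⇒quotAdj {P} {F} b∈ x y _ xy with blockAdj⁻ P F xy
    ... | w , ew , w≤m , x∈ , y∈ =
      any-true⁺ _ Q S∖P∈Q (cong₂ _∧_ (∈ₛ-∖ᵇ⁺ S P u∈S (proj₂ (∈-blockVerts⁻ P F x∈)))
                                     (∈ₛ-∖ᵇ⁺ S P v∈S (proj₂ (∈-blockVerts⁻ P F y∈))))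
      where
      open SmallConnectedSet (pathMin-smallConnectedSet P F n ew)
      S∈H : S ∈ Hm m Γ
      S∈H = ∈-Hm⁺ S (≤-trans ∣S∣≤1+w (s≤s w≤m)) (reachable⇒components≡1 (adj-sym Γ) u∈S reachable)
      S∖P∈Q : S ∖ᵇ P ∈ Q
      S∖P∈Q = ∈-quotFrom⁺ (Hm m Γ) emptySet Fs b∈ S∈H S⊆F

    reach-quot≡reach-block : ∀ {P F} → (P , F) ∈ blocks emptySet Fs → ∀ {v} → v ∈ₛ blockVerts P F → ∀ u
                           → reach fullSet quotAdj n u v
                           ≡ (mem (blockVerts P F) u ∧ reach (blockVerts P F) (blockAdj P F) n u v)
    reach-quot≡reach-block {P} {F} b∈ {v} v∈ u = ≡-from-true⇔ toBlock fromBlock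
      where
      toBlock : reach fullSet quotAdj n u v ≡ true → (mem (blockVerts P F) u ∧ reach (blockVerts P F) (blockAdj P F) n u v) ≡ true
      toBlock r with _ , p ← reach⇒reachable n u v r
                with u∈ , u⇝v ← quotPath⇒blockReachable b∈ p v∈ = cong₂ _∧_ u∈ (reachable⇒reach u⇝v)
      fromBlock : (mem (blockVerts P F) u ∧ reach (blockVerts P F) (blockAdj P F) n u v) ≡ true → reach fullSet quotAdj n u v ≡ true
      fromBlock r with _ , p ← reach⇒reachable n u v (proj₂ (∧-true⁻ {mem (blockVerts P F) u} r)) =
        reachable⇒reach (_ , path-mono (blockAdj⇒quotAdj b∈) (λ x _ → ∈ₛ-fullSet x) p)

    isLeader-quot≡isLeader-block : ∀ {P F} → (P , F) ∈ blocks emptySet Fs → ∀ {v} → v ∈ₛ blockVerts P F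
                                 → isLeader fullSet quotAdj v ≡ isLeader (blockVerts P F) (blockAdj P F) v
    isLeader-quot≡isLeader-block {P} {F} b∈ {v} v∈ =
      cong₂ (λ a b → a ∧ not b) (trans (∈ₛ-fullSet v) (sym v∈)) (any-cong _ _ (vertices n) sameCondition)
      where
      sameCondition : ∀ u → (mem fullSet u ∧ (toℕ u <ᵇ toℕ v) ∧ reach fullSet quotAdj n u v)
                          ≡ (mem (blockVerts P F) u ∧ (toℕ u <ᵇ toℕ v) ∧ reach (blockVerts P F) (blockAdj P F) n u v)
      sameCondition u =
        trans (cong₂ (λ a r → a ∧ (toℕ u <ᵇ toℕ v) ∧ r) (∈ₛ-fullSet u) (reach-quot≡reach-block b∈ v∈ u))
              (∧-leftComm (toℕ u <ᵇ toℕ v) (mem (blockVerts P F) u) _)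

    blockLeaders≡quotLeader : ∀ {P Fs′ v} → Chain P Fs′ → (∀ {b} → b ∈ blocks P Fs′ → b ∈ blocks emptySet Fs) → v ∉ₛ P
                            → blockLeaders v P Fs′ ≡ indicator (isLeader fullSet quotAdj v)
    blockLeaders≡quotLeader {v = v} (top P-full) _ v∉P = ⊥-elim (true≢false (trans (sym (P-full v)) v∉P))
    blockLeaders≡quotLeader {P} {F ∷ Fs′} {v} (step P⊆F c) sub v∉P with mem F v in v∈F?
    ... | true  =
      trans (cong₂ _+_ (cong indicator (sym (isLeader-quot≡isLeader-block (sub (here refl)) (∈-blockVerts⁺ P F v∈F? v∉P))))
                       (blockLeaders-below c v∈F?))
            (+-identityʳ _)
    ... | false =
      trans (cong (_+ blockLeaders v F Fs′) (cong indicator (∉ₛ⇒¬isLeader (blockVerts P F) (blockAdj P F) v∉block)))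
            (blockLeaders≡quotLeader c (sub ∘′ there) v∈F?)
      where
      v∉block : v ∉ₛ blockVerts P F
      v∉block rewrite mem-blockVerts P F v | v∈F? = refl

    componentsH-quotFlag : componentsH (quotFlag (Hm m Γ) Fs) ≡ compSumFrom m (Γ¹ Γ) emptySet Fs
    componentsH-quotFlag = begin
      componentsH Q                                                   ≡⟨ components≡count-isLeader fullSet quotAdj ⟩
      count (isLeader fullSet quotAdj) (vertices n)                   ≡⟨ count≡sumOver (isLeader fullSet quotAdj) (vertices n) ⟩
      sumOver (indicator ∘′ isLeader fullSet quotAdj) (vertices n)      ≡⟨ sumOver-cong _ _ (vertices n) eachVertex ⟩
      sumOver (λ v → blockLeaders v emptySet Fs) (vertices n)         ≡⟨ compSumFrom≡sumOver-blockLeaders emptySet Fs ⟨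
      compSumFrom m (Γ¹ Γ) emptySet Fs                                ∎
      where
      open ≡-Reasoning
      eachVertex : ∀ v → v ∈ vertices n → indicator (isLeader fullSet quotAdj v) ≡ blockLeaders v emptySet Fs
      eachVertex v _ = sym (blockLeaders≡quotLeader chain (λ b∈ → b∈) (∉ₛ-emptySet v))

mainTheorem2 : ∀ {n : ℕ} (Γ : SimpleGraph n) (m : ℕ) → FqGraph Γ m ≈Q Ψ m (Γ¹ Γ)
mainTheorem2 {n} Γ m = ↭-reflexive (map-cong-local (All.tabulate sameTerm))
  where
  sameTerm : ∀ {Fs} → Fs ∈ allFlags n → (rkH (quotFlag (Hm m Γ) Fs) , flagType Fs) ≡ (rkm m (Γ¹ Γ) Fs , flagType Fs)
  sameTerm Fs∈ = cong (λ c → n ∸ c , flagType _) (componentsH-quotFlag Γ m (allFlags⇒Chain Fs∈))
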